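{- Let $H$ be a Heyting algebra. Then $H$ is a finite regular Heyting algebra if and only if its dual $\mathfrak E_H$ is a finite poset satisfying (i) for every non-maximal $x\in\mathfrak E_H$, $|S(x)|\ge 2$; (ii) for all non-maximal $x,y\in\mathfrak E_H$, if $x\neq y$ then $S(x)\neq S(y)$. Moreover, $H$ is a finite regular subdirectly irreducible Heyting algebra if and only if $\mathfrak E_H$ is a finite rooted poset satisfying (i) and (ii).
   Context: For a Heyting algebra $H$, $\mathfrak E_H$ is its dual Esakia space; when $H$ is finite this is the finite poset of prime filters of $H$ ordered by inclusion (with discrete topology), and $H$ is isomorphic to the algebra of upsets of this poset. An element $x\in H$ is regular if $x=\neg\neg x$; $H$ is regular if it is generated as a Heyting algebra by its regular elements. A poset is rooted if it has a least element. For $x$ in a finite poset, $S(x)=\{y : x<y \text{ and there is no } z \text{ with } x<z<y\}$ is the set of immediate successors of $x$. -}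

module Defs where

open import Level using (Level; _⊔_; suc)
open import Data.Nat using (ℕ)
open import Data.Fin using (Fin)
open import Data.Product using (Σ; ∃; _×_; _,_)
open import Data.Sum using (_⊎_)
open import Relation.Nullary using (¬_)
open import Relation.Binary.PropositionalEquality using (_≡_)
open import Relation.Binary.Lattice.Bundles using (HeytingAlgebra)

module _ {c ℓ₁ ℓ₂ : Level} (H : HeytingAlgebra c ℓ₁ ℓ₂) where

  open HeytingAlgebra H

  L : Level
  L = c ⊔ ℓ₁ ⊔ ℓ₂

  FiniteHA : Set (c ⊔ ℓ₁)
  FiniteHA = Σ ℕ λ n → Σ (Fin n → Carrier) λ f →
    (∀ x → Σ (Fin n) λ i → f i ≈ x) × (∀ i j → f i ≈ f j → i ≡ j)

  ¬ₕ_ : Carrier → Carrier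
  ¬ₕ x = x ⇨ ⊥

  IsRegularElement : Carrier → Set ℓ₁
  IsRegularElement x = x ≈ ¬ₕ (¬ₕ x)

  data Generated : Carrier → Set L where
    gen-reg : ∀ {x} → IsRegularElement x → Generated x
    gen-⊤   : Generated ⊤
    gen-⊥   : Generated ⊥
    gen-∧   : ∀ {x y} → Generated x → Generated y → Generated (x ∧ y)
    gen-∨   : ∀ {x y} → Generated x → Generated y → Generated (x ∨ y)
    gen-⇨   : ∀ {x y} → Generated x → Generated y → Generated (x ⇨ y)
    gen-≈   : ∀ {x y} → x ≈ y → Generated x → Generated y

  RegularHA : Set L
  RegularHA = ∀ x → Generated x

  -- Prime filters (points of the dual Esakia space)

  record PrimeFilter : Set (suc L) where
    field
      _∈F    : Carrier → Set L
      ⊤∈     : ⊤ ∈F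
      up     : ∀ {x y} → x ≤ y → x ∈F → y ∈F
      ∧-cl   : ∀ {x y} → x ∈F → y ∈F → (x ∧ y) ∈F
      proper : ¬ (⊥ ∈F)
      prime  : ∀ {x y} → (x ∨ y) ∈F → (x ∈F) ⊎ (y ∈F)

  open PrimeFilter public

  _⊆F_ : PrimeFilter → PrimeFilter → Set L
  P ⊆F Q = ∀ x → (P ∈F) x → (Q ∈F) x

  _≐F_ : PrimeFilter → PrimeFilter → Set L
  P ≐F Q = (P ⊆F Q) × (Q ⊆F P)

  _⊂F_ : PrimeFilter → PrimeFilter → Set L
  P ⊂F Q = (P ⊆F Q) × ¬ (Q ⊆F P)

  FiniteDual : Set (suc L)
  FiniteDual = Σ ℕ λ n → Σ (Fin n → PrimeFilter) λ g →
    (∀ P → Σ (Fin n) λ i → g i ≐F P) × (∀ i j → g i ≐F g j → i ≡ j)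

  ImmSucc : PrimeFilter → PrimeFilter → Set (suc L)
  ImmSucc P Q = (P ⊂F Q) × (∀ R → ¬ ((P ⊂F R) × (R ⊂F Q)))

  NonMaximal : PrimeFilter → Set (suc L)
  NonMaximal P = Σ PrimeFilter λ Q → P ⊂F Q

  SameSucc : PrimeFilter → PrimeFilter → Set (suc L)
  SameSucc P P' = ∀ Q → (ImmSucc P Q → ImmSucc P' Q) × (ImmSucc P' Q → ImmSucc P Q)

  CondI : Set (suc L)
  CondI = ∀ P → NonMaximal P →
    Σ PrimeFilter λ Q₁ → Σ PrimeFilter λ Q₂ →
      ImmSucc P Q₁ × ImmSucc P Q₂ × ¬ (Q₁ ≐F Q₂)

  CondII : Set (suc L)
  CondII = ∀ P P' → NonMaximal P → NonMaximal P' → ¬ (P ≐F P') → ¬ SameSucc P P'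

  Rooted : Set (suc L)
  Rooted = Σ PrimeFilter λ R → ∀ P → R ⊆F P

  record Congruence : Set (suc L) where
    field
      θ      : Carrier → Carrier → Set L
      ≈⇒θ    : ∀ {x y} → x ≈ y → θ x y
      θ-sym  : ∀ {x y} → θ x y → θ y x
      θ-trans : ∀ {x y z} → θ x y → θ y z → θ x z
      ∧-cong : ∀ {x y u v} → θ x y → θ u v → θ (x ∧ u) (y ∧ v)
      ∨-cong : ∀ {x y u v} → θ x y → θ u v → θ (x ∨ u) (y ∨ v)
      ⇨-cong : ∀ {x y u v} → θ x y → θ u v → θ (x ⇨ u) (y ⇨ v)

  open Congruence public

  NonTrivialCong : Congruence → Set L
  NonTrivialCong Θ = Σ Carrier λ a → Σ Carrier λ b → θ Θ a b × ¬ (a ≈ b)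

  SubdirectlyIrreducible : Set (suc L)
  SubdirectlyIrreducible = Σ Congruence λ μ → NonTrivialCong μ ×
    (∀ Θ → NonTrivialCong Θ → ∀ a b → θ μ a b → θ Θ a b)

  PrimeFilterTheorem : Set (suc L)
  PrimeFilterTheorem = ∀ a b → ¬ (a ≤ b) →
    Σ PrimeFilter λ P → (P ∈F) a × ¬ ((P ∈F) b)

{-# OPTIONS --safe #-}
module Submission where

-- With excluded middle and the prime filter theorem an element of H is determined by the points
-- (prime filters) containing it, so identities are checked pointwise. In a finite H every point is
-- the principal filter of a prime element; this gives the finite dual and the Esakia condition
-- (a ⇨ b ∈ Q iff b ∈ R for every R ⊇ Q containing a).
--
-- Call P and P′ twins if they have a common upper bound and every extension of either one is
-- contained in it or contains the other. Twins contain the same elements of the subalgebra generated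
-- by the regular elements, so in a regular algebra twins are equal. A non-maximal point with a single
-- cover is a twin of that cover, and two non-maximal points with the same covers are twins: this
-- gives (i) and (ii).
--
-- Conversely, under (i) and (ii) any X ⊈ Z are separated by a generated element, by induction on the
-- number of points strictly above X or Z. If Z is maximal, ¬¬x separates for any x ∈ X ∖ Z; if some
-- cover of Z does not contain X, recurse there. Otherwise (i) puts X strictly below every cover of Z,
-- so by (ii) some cover Y of X is not strictly above Z, and A ⇨ B separates, where A ∈ Z ∖ Y and B
-- holds strictly above X but not at Z. Every element is then a join of meets of separators.
--
-- Rootedness and subdirect irreducibility both amount to an opremum, a largest element below ⊤:
-- its filter congruence is the monolith, and {⊤} is the root.

open import Defs
open import Level using (Level; _⊔_; Lift; lift; lower) renaming (suc to lsuc)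
open import Function using (_∘_; _⇔_; mk⇔)
open import Data.Empty using (⊥-elim)
open import Data.Product using (Σ; ∃; _×_; _,_; proj₁; proj₂; swap)
open import Data.Sum using (_⊎_; inj₁; inj₂; [_,_]) renaming (map to ⊎-map)
open import Data.Nat using (ℕ; zero; suc; _+_; _<_)
open import Data.Nat.Induction using (<-wellFounded)
import Data.Nat.Properties as ℕ
open import Data.Fin using (Fin; zero; suc)
open import Data.Fin.Properties using (any?)
open import Data.Fin.Subset using (Subset; inside; outside; ∣_∣) renaming (_∈_ to _∈ₛ_)
open import Data.Fin.Subset.Properties using (p⊂q⇒∣p∣<∣q∣)
open import Data.Vec using ([]; _∷_; tabulate)
open import Data.Vec.Properties using (lookup∘tabulate; lookup⇒[]=; []=⇒lookup)
import Data.Vec.Functional as Vector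
open import Data.List using (List; []; _∷_; _++_; map; allFin)
open import Data.List.Relation.Unary.Any using (Any; here; there) renaming (map to Any-map)
open import Data.List.Relation.Unary.All using (All; []; _∷_; lookupAny)
open import Data.List.Membership.Propositional using (_∈_)
open import Data.List.Membership.Propositional.Properties using (∈-allFin; ∈-map⁺; ∈-++⁺ˡ; ∈-++⁺ʳ)
open import Relation.Nullary using (¬_; Dec; yes; no; does)
open import Relation.Nullary.Decidable using (dec-true; map′)
open import Relation.Unary using (Pred; Decidable)
open import Relation.Binary using (Rel; IsDecEquivalence; Setoid)
import Relation.Binary.Reasoning.Setoid as SetoidReasoning
open import Relation.Binary.PropositionalEquality using (_≡_; refl; sym; trans; cong; subst)
open import Induction.WellFounded using (Acc; acc)
open import Axiom.ExcludedMiddle using (ExcludedMiddle)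
open import Relation.Binary.Lattice.Bundles using (HeytingAlgebra)

select : ∀ {n p} {P : Pred (Fin n) p} → Decidable P → Subset n
select P? = tabulate (does ∘ P?)

module _ {n p} {P : Pred (Fin n) p} (P? : Decidable P) where

  ∈-select⁺ : ∀ {i} → P i → i ∈ₛ select P?
  ∈-select⁺ {i} pi = lookup⇒[]= i (select P?) (trans (lookup∘tabulate _ i) (dec-true (P? i) pi))

  ∈-select⁻ : ∀ {i} → i ∈ₛ select P? → P i
  ∈-select⁻ {i} i∈ with P? i | trans (sym (lookup∘tabulate (does ∘ P?) i)) ([]=⇒lookup i∈)
  ... | yes pi | _ = pi
  ... | no _ | ()

∣select∣-< : ∀ {n p q} {P : Pred (Fin n) p} {Q : Pred (Fin n) q} (P? : Decidable P) (Q? : Decidable Q) →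
  (∀ {i} → P i → Q i) → ∀ {j} → Q j → ¬ P j → ∣ select P? ∣ < ∣ select Q? ∣
∣select∣-< P? Q? P⇒Q qj ¬pj =
  p⊂q⇒∣p∣<∣q∣ (∈-select⁺ Q? ∘ P⇒Q ∘ ∈-select⁻ P? , _ , ∈-select⁺ Q? qj , ¬pj ∘ ∈-select⁻ P?)

allSubsets : ∀ m → List (Subset m)
allSubsets zero = [] ∷ []
allSubsets (suc m) = map (inside ∷_) (allSubsets m) ++ map (outside ∷_) (allSubsets m)

∈-allSubsets : ∀ {m} (v : Subset m) → v ∈ allSubsets m
∈-allSubsets [] = here refl
∈-allSubsets (inside ∷ v) = ∈-++⁺ˡ (∈-map⁺ (inside ∷_) (∈-allSubsets v))
∈-allSubsets {suc m} (outside ∷ v) =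
  ∈-++⁺ʳ (map (inside ∷_) (allSubsets m)) (∈-map⁺ (outside ∷_) (∈-allSubsets v))

module _ {a b r} {A : Set a} {B : Set b} {R : A → B → Set r} (R? : ∀ x → Dec (Σ B (R x))) where

  witnesses : List A → List B
  witnesses [] = []
  witnesses (x ∷ xs) with R? x
  ... | yes (y , _) = y ∷ witnesses xs
  ... | no _ = witnesses xs

  witnesses-complete : ∀ {x xs} → x ∈ xs → Σ B (R x) → Any (R x) (witnesses xs)
  witnesses-complete {xs = y ∷ xs} (here refl) w with R? y
  ... | yes (_ , r) = here r
  ... | no ¬w = ⊥-elim (¬w w)
  witnesses-complete {xs = y ∷ xs} (there x∈xs) w with R? y
  ... | yes _ = there (witnesses-complete x∈xs w)
  ... | no _ = witnesses-complete x∈xs w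

Enumerable : ∀ {b ℓ} {B : Set b} → Rel B ℓ → Set (b ⊔ ℓ)
Enumerable {B = B} _~_ = Σ ℕ λ n → Σ (Fin n → B) λ g →
  (∀ x → Σ (Fin n) λ i → g i ~ x) × (∀ i j → g i ~ g j → i ≡ j)

module _ {b ℓ} {B : Set b} {_~_ : Rel B ℓ} (isDecEquivalence : IsDecEquivalence _~_) where

  open IsDecEquivalence isDecEquivalence renaming (refl to ~-refl; sym to ~-sym; trans to ~-trans)

  private
    enumerateClasses : (xs : List B) → Σ ℕ λ n → Σ (Fin n → B) λ g →
      All (λ x → Σ (Fin n) λ i → g i ~ x) xs × (∀ i j → g i ~ g j → i ≡ j)
    enumerateClasses [] = 0 , (λ ()) , [] , (λ ())
    enumerateClasses (x ∷ xs) with enumerateClasses xs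
    ... | n , g , covered , injective with any? (λ i → g i ≟ x)
    ...   | yes found = n , g , found ∷ covered , injective
    ...   | no new = suc n , x Vector.∷ g , (zero , ~-refl) ∷ shift covered , injective′
      where
      shift : ∀ {ys} → All (λ y → Σ (Fin n) λ i → g i ~ y) ys →
              All (λ y → Σ (Fin (suc n)) λ i → (x Vector.∷ g) i ~ y) ys
      shift [] = []
      shift ((i , gi~y) ∷ rest) = (suc i , gi~y) ∷ shift rest
      injective′ : ∀ i j → (x Vector.∷ g) i ~ (x Vector.∷ g) j → i ≡ j
      injective′ zero zero _ = refl
      injective′ zero (suc j) x~gj = ⊥-elim (new (j , ~-sym x~gj))
      injective′ (suc i) zero gi~x = ⊥-elim (new (i , gi~x))
      injective′ (suc i) (suc j) gi~gj = cong suc (injective i j gi~gj)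

  enumerable-of-cover : (xs : List B) → (∀ x → Any (_~ x) xs) → Enumerable _~_
  enumerable-of-cover xs cover with enumerateClasses xs
  ... | n , g , covered , injective = n , g , surjective , injective
    where
    surjective : ∀ x → Σ (Fin n) λ i → g i ~ x
    surjective x with lookupAny covered (cover x)
    ... | (i , gi~y) , y~x = i , ~-trans gi~y y~x

module Duality {c ℓ₁ ℓ₂} (em : ExcludedMiddle (c ⊔ ℓ₁ ⊔ ℓ₂))
  (H : HeytingAlgebra c ℓ₁ ℓ₂) (pft : PrimeFilterTheorem H) where

  open HeytingAlgebra H renaming (refl to ≤-refl; trans to ≤-trans; reflexive to ≤-reflexive)
  open import Relation.Binary.Lattice.Properties.HeytingAlgebra H using (⇨-eval; x≤¬¬x; ⇨ˡ-contravariant; ⇨-unit)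
  open import Relation.Binary.Lattice.Properties.BoundedLattice boundedLattice using (∨-zeroˡ)
  open import Relation.Binary.Lattice.Properties.BoundedMeetSemilattice boundedMeetSemilattice using (identityʳ)
  open import Relation.Binary.Lattice.Properties.MeetSemilattice meetSemilattice using (∧-idempotent)
  open import Relation.Binary.Lattice.Properties.JoinSemilattice joinSemilattice using (x≤y⇒x∨y≈y)

  Lv : Level
  Lv = c ⊔ ℓ₁ ⊔ ℓ₂

  Point : Set (lsuc Lv)
  Point = PrimeFilter H

  -- An injective wrapper of (P ∈F) a: through the projection Agda cannot infer P.
  record _∈P_ (a : Carrier) (P : Point) : Set Lv where
    constructor mk
    field get : (P ∈F) a
  open _∈P_ public

  infix 4 _∈P_ _⊆_ _⊂_ _≐_ _≤?_ _≈?_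

  private
    variable
      a b x y u v : Carrier
      P P′ Q R S X Y Z : Point

  _⊆_ _⊂_ _≐_ : Point → Point → Set Lv
  P ⊆ Q = ∀ x → x ∈P P → x ∈P Q
  P ⊂ Q = P ⊆ Q × ¬ (Q ⊆ P)
  P ≐ Q = P ⊆ Q × Q ⊆ P

  ⊆-refl : P ⊆ P
  ⊆-refl _ p = p

  ⊆-trans : P ⊆ Q → Q ⊆ R → P ⊆ R
  ⊆-trans P⊆Q Q⊆R x = Q⊆R x ∘ P⊆Q x

  ⊂-⊆-trans : P ⊂ Q → Q ⊆ R → P ⊂ R
  ⊂-⊆-trans (P⊆Q , Q⊈P) Q⊆R = ⊆-trans P⊆Q Q⊆R , λ R⊆P → Q⊈P (⊆-trans Q⊆R R⊆P)

  ⊆-⊂-trans : P ⊆ Q → Q ⊂ R → P ⊂ R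
  ⊆-⊂-trans P⊆Q (Q⊆R , R⊈Q) = ⊆-trans P⊆Q Q⊆R , λ R⊆P → R⊈Q (⊆-trans R⊆P P⊆Q)

  ⊂-irrefl : ¬ (P ⊂ P)
  ⊂-irrefl (_ , P⊈P) = P⊈P ⊆-refl

  ⊆-resp-≐ : Q ≐ R → P ⊆ Q → P ⊆ R
  ⊆-resp-≐ (Q⊆R , _) P⊆Q = ⊆-trans P⊆Q Q⊆R

  ⊂-resp-≐ : Q ≐ R → P ⊂ Q → P ⊂ R
  ⊂-resp-≐ (Q⊆R , _) P⊂Q = ⊂-⊆-trans P⊂Q Q⊆R

  ⊆⇒⊆F : P ⊆ Q → _⊆F_ H P Q
  ⊆⇒⊆F P⊆Q x p = get (P⊆Q x (mk p))

  ⊆F⇒⊆ : _⊆F_ H P Q → P ⊆ Q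
  ⊆F⇒⊆ P⊆Q x p = mk (P⊆Q x (get p))

  ⊂⇒⊂F : P ⊂ Q → _⊂F_ H P Q
  ⊂⇒⊂F (P⊆Q , Q⊈P) = ⊆⇒⊆F P⊆Q , Q⊈P ∘ ⊆F⇒⊆

  ⊂F⇒⊂ : _⊂F_ H P Q → P ⊂ Q
  ⊂F⇒⊂ (P⊆Q , Q⊈P) = ⊆F⇒⊆ P⊆Q , Q⊈P ∘ ⊆⇒⊆F

  stable : {A : Set Lv} → ¬ ¬ A → A
  stable {A} ¬¬A with em {A}
  ... | yes A = A
  ... | no ¬A = ⊥-elim (¬¬A ¬A)

  ⊆⇒⊆-or-⊂ : P ⊆ R → R ⊆ P ⊎ P ⊂ R
  ⊆⇒⊆-or-⊂ {P} {R} P⊆R with em {R ⊆ P}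
  ... | yes R⊆P = inj₁ R⊆P
  ... | no R⊈P = inj₂ (P⊆R , R⊈P)

  _≤?_ : ∀ x y → Dec (x ≤ y)
  x ≤? y = map′ lower lift (em {Lift Lv (x ≤ y)})

  _≈?_ : ∀ x y → Dec (x ≈ y)
  x ≈? y = map′ lower lift (em {Lift Lv (x ≈ y)})

  ∈-resp-≤ : a ≤ b → a ∈P P → b ∈P P
  ∈-resp-≤ {P = P} a≤b (mk a∈P) = mk (up P a≤b a∈P)

  ∈-resp-≈ : a ≈ b → a ∈P P → b ∈P P
  ∈-resp-≈ = ∈-resp-≤ ∘ ≤-reflexive

  ⊤-∈ : ⊤ ∈P P
  ⊤-∈ {P} = mk (⊤∈ P)

  ⊥-∉ : ¬ (⊥ ∈P P)
  ⊥-∉ {P} (mk ⊥∈P) = proper P ⊥∈P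

  ∧-∈⁺ : a ∈P P → b ∈P P → a ∧ b ∈P P
  ∧-∈⁺ {P = P} (mk a∈P) (mk b∈P) = mk (∧-cl P a∈P b∈P)

  ∧-∈⁻ˡ : a ∧ b ∈P P → a ∈P P
  ∧-∈⁻ˡ = ∈-resp-≤ (x∧y≤x _ _)

  ∧-∈⁻ʳ : a ∧ b ∈P P → b ∈P P
  ∧-∈⁻ʳ = ∈-resp-≤ (x∧y≤y _ _)

  ∨-∈⁺ˡ : a ∈P P → a ∨ b ∈P P
  ∨-∈⁺ˡ = ∈-resp-≤ (x≤x∨y _ _)

  ∨-∈⁺ʳ : b ∈P P → a ∨ b ∈P P
  ∨-∈⁺ʳ = ∈-resp-≤ (y≤x∨y _ _)

  ∨-∈⁻ : a ∨ b ∈P P → a ∈P P ⊎ b ∈P P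
  ∨-∈⁻ {P = P} (mk a∨b∈P) = ⊎-map mk mk (prime P a∨b∈P)

  ⇨-∈⁻ : a ⇨ b ∈P P → a ∈P P → b ∈P P
  ⇨-∈⁻ a⇨b∈P a∈P = ∈-resp-≤ ⇨-eval (∧-∈⁺ a⇨b∈P a∈P)

  ≤-pointwise : (∀ P → a ∈P P → b ∈P P) → a ≤ b
  ≤-pointwise {a} {b} a⊑b with a ≤? b
  ... | yes a≤b = a≤b
  ... | no a≰b with pft a b a≰b
  ...   | P , a∈P , b∉P = ⊥-elim (b∉P (get (a⊑b P (mk a∈P))))

  ≈-pointwise : (∀ P → a ∈P P → b ∈P P) → (∀ P → b ∈P P → a ∈P P) → a ≈ b
  ≈-pointwise a⊑b b⊑a = antisym (≤-pointwise a⊑b) (≤-pointwise b⊑a)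

  ⋀ ⋁ : ∀ {k} → (Fin k → Carrier) → Carrier
  ⋀ = Vector.foldr _∧_ ⊤
  ⋁ = Vector.foldr _∨_ ⊥

  ⋀-∈⁺ : ∀ {k} (h : Fin k → Carrier) → (∀ i → h i ∈P P) → ⋀ h ∈P P
  ⋀-∈⁺ {k = zero} h _ = ⊤-∈
  ⋀-∈⁺ {k = suc k} h h∈P = ∧-∈⁺ (h∈P zero) (⋀-∈⁺ (h ∘ suc) (h∈P ∘ suc))

  ⋀-∈⁻ : ∀ {k} (h : Fin k → Carrier) → ⋀ h ∈P P → ∀ i → h i ∈P P
  ⋀-∈⁻ h ⋀h∈P zero = ∧-∈⁻ˡ ⋀h∈P
  ⋀-∈⁻ h ⋀h∈P (suc i) = ⋀-∈⁻ (h ∘ suc) (∧-∈⁻ʳ ⋀h∈P) i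

  ⋁-∈⁺ : ∀ {k} (h : Fin k → Carrier) i → h i ∈P P → ⋁ h ∈P P
  ⋁-∈⁺ h zero hi∈P = ∨-∈⁺ˡ hi∈P
  ⋁-∈⁺ h (suc i) hi∈P = ∨-∈⁺ʳ (⋁-∈⁺ (h ∘ suc) i hi∈P)

  ⋁-∈⁻ : ∀ {k} (h : Fin k → Carrier) → ⋁ h ∈P P → ∃ λ i → h i ∈P P
  ⋁-∈⁻ {k = zero} h ⊥∈P = ⊥-elim (⊥-∉ ⊥∈P)
  ⋁-∈⁻ {k = suc k} h ⋁h∈P with ∨-∈⁻ ⋁h∈P
  ... | inj₁ h0∈P = zero , h0∈P
  ... | inj₂ rest∈P = let i , hsi∈P = ⋁-∈⁻ (h ∘ suc) rest∈P in suc i , hsi∈P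

  ⋀-generated : ∀ {k} (h : Fin k → Carrier) → (∀ i → Generated H (h i)) → Generated H (⋀ h)
  ⋀-generated {k = zero} h _ = gen-⊤
  ⋀-generated {k = suc k} h gen = gen-∧ (gen zero) (⋀-generated (h ∘ suc) (gen ∘ suc))

  ⋁-generated : ∀ {k} (h : Fin k → Carrier) → (∀ i → Generated H (h i)) → Generated H (⋁ h)
  ⋁-generated {k = zero} h _ = gen-⊥
  ⋁-generated {k = suc k} h gen = gen-∨ (gen zero) (⋁-generated (h ∘ suc) (gen ∘ suc))

  ¬¬-isRegular : ∀ x → IsRegularElement H ((x ⇨ ⊥) ⇨ ⊥)
  ¬¬-isRegular x = antisym (x≤¬¬x _) (⇨ˡ-contravariant (x≤¬¬x (x ⇨ ⊥)))

  ≈-isDecEquivalence : IsDecEquivalence _≈_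
  ≈-isDecEquivalence = record { isEquivalence = isEquivalence ; _≟_ = _≈?_ }

  ≐F-isDecEquivalence : IsDecEquivalence (_≐F_ H)
  ≐F-isDecEquivalence = record
    { isEquivalence = record
      { refl = (λ _ p → p) , (λ _ p → p)
      ; sym = λ (P⊆Q , Q⊆P) → Q⊆P , P⊆Q
      ; trans = λ (P⊆Q , Q⊆P) (Q⊆R , R⊆Q) → (λ x → Q⊆R x ∘ P⊆Q x) , (λ x → Q⊆P x ∘ R⊆Q x)
      }
    ; _≟_ = λ _ _ → em
    }

  biimplication-≈⊤ : (a ⇨ b) ∧ (b ⇨ a) ≈ ⊤ → a ≈ b
  biimplication-≈⊤ a⇔b≈⊤ = ≈-pointwise
    (λ _ → ⇨-∈⁻ (∧-∈⁻ˡ (∈-resp-≈ (Eq.sym a⇔b≈⊤) ⊤-∈)))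
    (λ _ → ⇨-∈⁻ (∧-∈⁻ʳ (∈-resp-≈ (Eq.sym a⇔b≈⊤) ⊤-∈)))

  IsOpremum : Carrier → Set Lv
  IsOpremum d = ¬ (d ≈ ⊤) × (∀ x → ¬ (x ≈ ⊤) → x ≤ d)

  opremum⇒rooted : ∀ {d} → IsOpremum d → Rooted H
  opremum⇒rooted {d} (d≉⊤ , below) = topFilter , λ P x x≈⊤ → get (∈-resp-≈ {P = P} (Eq.sym (lower x≈⊤)) ⊤-∈)
    where
    ⊤≤ : x ≈ ⊤ → ⊤ ≤ x
    ⊤≤ = ≤-reflexive ∘ Eq.sym
    ≈⊤ : ⊤ ≤ x → x ≈ ⊤
    ≈⊤ = antisym (maximum _)
    prime-⊤ : ∀ x y → x ∨ y ≈ ⊤ → Lift Lv (x ≈ ⊤) ⊎ Lift Lv (y ≈ ⊤)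
    prime-⊤ x y x∨y≈⊤ with x ≈? ⊤ | y ≈? ⊤
    ... | yes x≈⊤ | _ = inj₁ (lift x≈⊤)
    ... | no _ | yes y≈⊤ = inj₂ (lift y≈⊤)
    ... | no x≉⊤ | no y≉⊤ = ⊥-elim (d≉⊤ (≈⊤ (≤-trans (⊤≤ x∨y≈⊤) (∨-least (below x x≉⊤) (below y y≉⊤)))))
    topFilter : Point
    topFilter = record
      { _∈F = λ x → Lift Lv (x ≈ ⊤)
      ; ⊤∈ = lift Eq.refl
      ; up = λ x≤y x≈⊤ → lift (≈⊤ (≤-trans (⊤≤ (lower x≈⊤)) x≤y))
      ; ∧-cl = λ x≈⊤ y≈⊤ → lift (≈⊤ (∧-greatest (⊤≤ (lower x≈⊤)) (⊤≤ (lower y≈⊤))))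
      ; proper = λ ⊥≈⊤ → d≉⊤ (≈⊤ (≤-trans (⊤≤ (lower ⊥≈⊤)) (minimum d)))
      ; prime = λ {x} {y} x∨y≈⊤ → prime-⊤ x y (lower x∨y≈⊤)
      }

  congruenceSetoid : Congruence H → Setoid c Lv
  congruenceSetoid Θ = record
    { Carrier = Carrier
    ; _≈_ = θ Θ
    ; isEquivalence = record { refl = ≈⇒θ Θ Eq.refl ; sym = θ-sym Θ ; trans = θ-trans Θ }
    }

  module FromFiniteDual (fd : FiniteDual H) where

    private
      m = proj₁ fd
      point = proj₁ (proj₂ fd)
      point-surjective = proj₁ (proj₂ (proj₂ fd))

    profile : Carrier → Subset m
    profile a = select (λ i → em {a ∈P point i})

    profile-injective : profile a ≡ profile b → a ∈P P → b ∈P P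
    profile-injective {a} {b} {P} same a∈P with point-surjective P
    ... | i , iP , Pi = mk (iP b (get (∈-select⁻ (λ j → em {b ∈P point j}) i∈b)))
      where
      i∈b : i ∈ₛ profile b
      i∈b = subst (i ∈ₛ_) same (∈-select⁺ (λ j → em {a ∈P point j}) (mk (Pi a (get a∈P))))

    finiteHA : FiniteHA H
    finiteHA = enumerable-of-cover ≈-isDecEquivalence (witnesses hasProfile? (allSubsets m)) cover
      where
      hasProfile? : ∀ v → Dec (Σ Carrier λ a → profile a ≡ v)
      hasProfile? v = map′ lower lift (em {Lift Lv (Σ Carrier λ a → profile a ≡ v)})
      cover : ∀ a → Any (_≈ a) (witnesses hasProfile? (allSubsets m))
      cover a = Any-map
        (λ same → ≈-pointwise (λ _ → profile-injective same) (λ _ → profile-injective (sym same)))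
        (witnesses-complete hasProfile? (∈-allSubsets (profile a)) (a , refl))

  module Finite (fha : FiniteHA H) where

    private
      n = proj₁ fha
      elem = proj₁ (proj₂ fha)
      elem-surjective = proj₁ (proj₂ (proj₂ fha))

      elemIn : Point → Fin n → Carrier
      elemIn P i with em {elem i ∈P P}
      ... | yes _ = elem i
      ... | no _ = ⊤

      elemIn-∈ : ∀ P i → elemIn P i ∈P P
      elemIn-∈ P i with em {elem i ∈P P}
      ... | yes ei∈P = ei∈P
      ... | no _ = ⊤-∈

      elemIn-∈⇒ : ∀ P Q i → elem i ∈P P → elemIn P i ∈P Q → elem i ∈P Q
      elemIn-∈⇒ P Q i ei∈P ei∈Q with em {elem i ∈P P}
      ... | yes _ = ei∈Q
      ... | no ei∉P = ⊥-elim (ei∉P ei∈P)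

    generator : Point → Carrier
    generator P = ⋀ (elemIn P)

    generator-∈ : generator P ∈P P
    generator-∈ {P} = ⋀-∈⁺ (elemIn P) (elemIn-∈ P)

    generator-∈⇒⊆ : generator P ∈P Q → P ⊆ Q
    generator-∈⇒⊆ {P} {Q} gP∈Q x x∈P with elem-surjective x
    ... | i , ei≈x = ∈-resp-≈ ei≈x
      (elemIn-∈⇒ P Q i (∈-resp-≈ (Eq.sym ei≈x) x∈P) (⋀-∈⁻ (elemIn P) gP∈Q i))

    generator-≤ : x ∈P P → generator P ≤ x
    generator-≤ x∈P = ≤-pointwise λ Q gP∈Q → generator-∈⇒⊆ gP∈Q _ x∈P

    ⇨-∈⁺ : (∀ R → Q ⊆ R → a ∈P R → b ∈P R) → a ⇨ b ∈P Q
    ⇨-∈⁺ {Q} {a} {b} a⊑b with generator Q ∧ a ≤? b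
    ... | yes gQ∧a≤b = ∈-resp-≤ (transpose-⇨ gQ∧a≤b) generator-∈
    ... | no gQ∧a≰b with pft _ _ gQ∧a≰b
    ...   | R , gQ∧a∈R , b∉R =
      ⊥-elim (b∉R (get (a⊑b R (generator-∈⇒⊆ (∧-∈⁻ˡ (mk gQ∧a∈R))) (∧-∈⁻ʳ (mk gQ∧a∈R)))))

    IsPrimeElement : Carrier → Set (c ⊔ ℓ₂)
    IsPrimeElement p = (∀ x y → p ≤ x ∨ y → p ≤ x ⊎ p ≤ y) × ¬ (p ≤ ⊥)

    PrincipalAt : Carrier → Point → Set Lv
    PrincipalAt p P = ∀ x → (x ∈P P → p ≤ x) × (p ≤ x → x ∈P P)

    principal : ∀ {p} → IsPrimeElement p → Σ Point (PrincipalAt p)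
    principal {p} (p-prime , p≰⊥) = record
      { _∈F = λ x → Lift Lv (p ≤ x)
      ; ⊤∈ = lift (maximum p)
      ; up = λ x≤y p≤x → lift (≤-trans (lower p≤x) x≤y)
      ; ∧-cl = λ p≤x p≤y → lift (∧-greatest (lower p≤x) (lower p≤y))
      ; proper = p≰⊥ ∘ lower
      ; prime = λ {x} {y} p≤x∨y → ⊎-map lift lift (p-prime x y (lower p≤x∨y))
      } , λ x → lower ∘ get , mk ∘ lift

    principalAt-isPrime : ∀ {p} → PrincipalAt p P → IsPrimeElement p
    principalAt-isPrime principalAt =
      (λ x y p≤x∨y → ⊎-map (proj₁ (principalAt x)) (proj₁ (principalAt y))
                       (∨-∈⁻ (proj₂ (principalAt (x ∨ y)) p≤x∨y)))
      , ⊥-∉ ∘ proj₂ (principalAt ⊥)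

    principalAt-unique : ∀ {p} → PrincipalAt p P → PrincipalAt p Q → _≐F_ H P Q
    principalAt-unique P-at Q-at =
      (λ x → get ∘ proj₂ (Q-at x) ∘ proj₁ (P-at x) ∘ mk) , (λ x → get ∘ proj₂ (P-at x) ∘ proj₁ (Q-at x) ∘ mk)

    principalAt-generator : ∀ {p} → p ≈ generator P → PrincipalAt p P
    principalAt-generator p≈gP x =
      (λ x∈P → ≤-trans (≤-reflexive p≈gP) (generator-≤ x∈P)) ,
      (λ p≤x → ∈-resp-≤ (≤-trans (≤-reflexive (Eq.sym p≈gP)) p≤x) generator-∈)

    finiteDual : FiniteDual H
    finiteDual = enumerable-of-cover ≐F-isDecEquivalence (witnesses principal? (allFin n)) cover
      where
      principal? : ∀ i → Dec (Σ Point (PrincipalAt (elem i)))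
      principal? i with em {Lift Lv (IsPrimeElement (elem i))}
      ... | yes (lift isPrime) = yes (principal isPrime)
      ... | no ¬isPrime = no λ (_ , principalAt) → ¬isPrime (lift (principalAt-isPrime principalAt))
      cover : ∀ P → Any (λ Q → _≐F_ H Q P) (witnesses principal? (allFin n))
      cover P with elem-surjective (generator P)
      ... | i , ei≈gP = Any-map (λ Q-at → principalAt-unique Q-at P-at)
          (witnesses-complete principal? (∈-allFin i) (P , P-at))
        where P-at = principalAt-generator ei≈gP

    -- Covers

    private
      point = proj₁ (proj₂ finiteDual)

    point-surjective : ∀ P → ∃ λ k → point k ≐ P
    point-surjective P with proj₁ (proj₂ (proj₂ finiteDual)) P
    ... | k , kP , Pk = k , ⊆F⇒⊆ kP , ⊆F⇒⊆ Pk

    -- Quantifying over the enumeration keeps _⋖_ in Set Lv, where excluded middle applies.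
    _⋖_ : Point → Point → Set Lv
    X ⋖ S = X ⊂ S × (∀ k → ¬ (X ⊂ point k × point k ⊂ S))

    ⋖⇒⊂ : X ⋖ S → X ⊂ S
    ⋖⇒⊂ = proj₁

    ⋖⇒⊆ : X ⋖ S → X ⊆ S
    ⋖⇒⊆ = proj₁ ∘ ⋖⇒⊂

    ⋖⇒ImmSucc : X ⋖ S → ImmSucc H X S
    ⋖⇒ImmSucc (X⊂S , nothingBetween) = ⊂⇒⊂F X⊂S , λ R (X⊂R , R⊂S) →
      let k , kR , Rk = point-surjective R
      in nothingBetween k (⊂-⊆-trans (⊂F⇒⊂ X⊂R) Rk , ⊆-⊂-trans kR (⊂F⇒⊂ R⊂S))

    ImmSucc⇒⋖ : ImmSucc H X S → X ⋖ S
    ImmSucc⇒⋖ (X⊂S , nothingBetween) =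
      ⊂F⇒⊂ X⊂S , λ k (X⊂k , k⊂S) → nothingBetween (point k) (⊂⇒⊂F X⊂k , ⊂⇒⊂F k⊂S)

    cover-index : X ⋖ S → ∃ λ k → X ⋖ point k × point k ≐ S
    cover-index (X⊂S , nothingBetween) with point-surjective _
    ... | k , kS , Sk =
      k , (⊂-⊆-trans X⊂S Sk , λ j (X⊂j , j⊂k) → nothingBetween j (X⊂j , ⊂-⊆-trans j⊂k kS)) , kS , Sk

    covers-incomparable : Z ⋖ S → Z ⋖ Q → S ⊆ Q → Q ⊆ S
    covers-incomparable {S = S} Z⋖S Z⋖Q S⊆Q = stable λ Q⊈S →
      let k , kS , Sk = point-surjective S
      in proj₂ Z⋖Q k (⊂-⊆-trans (⋖⇒⊂ Z⋖S) Sk , ⊆-⊂-trans kS (S⊆Q , Q⊈S))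

    private
      above? : ∀ X k → Dec (X ⊂ point k)
      above? X k = em

      between? : ∀ X R k → Dec (X ⊂ point k × point k ⊂ R)
      between? X R k = em

    #above : Point → ℕ
    #above X = ∣ select (above? X) ∣

    #above-< : X ⊂ Y → #above Y < #above X
    #above-< {X} {Y} X⊂Y with point-surjective Y
    ... | k , kY , Yk = ∣select∣-< (above? Y) (above? X)
      (⊆-⊂-trans (proj₁ X⊂Y)) (⊂-⊆-trans X⊂Y Yk) (λ Y⊂k → ⊂-irrefl (⊂-⊆-trans Y⊂k kY))

    #between : Point → Point → ℕ
    #between X R = ∣ select (between? X R) ∣

    #between-< : ∀ {k} → X ⊂ point k → point k ⊂ R → #between X (point k) < #between X R
    #between-< {X = X} {R = R} {k = k} X⊂k k⊂R = ∣select∣-< (between? X (point k)) (between? X R)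
      (λ (X⊂j , j⊂k) → X⊂j , ⊂-⊆-trans j⊂k (proj₁ k⊂R)) (X⊂k , k⊂R) (⊂-irrefl ∘ proj₂)

    cover-below : X ⊂ R → ∃ λ S → X ⋖ S × S ⊆ R
    cover-below {X} {R} X⊂R = go R X⊂R (<-wellFounded (#between X R))
      where
      go : ∀ R → X ⊂ R → Acc _<_ (#between X R) → ∃ λ S → X ⋖ S × S ⊆ R
      go R X⊂R (acc smaller) with em {∃ λ k → X ⊂ point k × point k ⊂ R}
      ... | no nothingBetween = R , (X⊂R , λ k between → nothingBetween (k , between)) , ⊆-refl
      ... | yes (k , X⊂k , k⊂R) with go (point k) X⊂k (smaller (#between-< X⊂k k⊂R))
      ...   | S , X⋖S , S⊆k = S , X⋖S , ⊆-trans S⊆k (proj₁ k⊂R)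

    nonMaximal⇒cover : NonMaximal H X → ∃ (X ⋖_)
    nonMaximal⇒cover (R , X⊂R) with cover-below {R = R} (⊂F⇒⊂ X⊂R)
    ... | S , X⋖S , _ = S , X⋖S

    -- Regularity implies (i) and (ii)

    record Twins (P P′ : Point) : Set (lsuc Lv) where
      field
        upperBound : ∃ λ T → P ⊆ T × P′ ⊆ T
        aboveˡ : ∀ R → P ⊆ R → R ⊆ P ⊎ P′ ⊆ R
        aboveʳ : ∀ R → P′ ⊆ R → R ⊆ P′ ⊎ P ⊆ R

    twins-sym : Twins P P′ → Twins P′ P
    twins-sym tw = record
      { upperBound = let T , P⊆T , P′⊆T = upperBound in T , P′⊆T , P⊆T
      ; aboveˡ = aboveʳ
      ; aboveʳ = aboveˡ
      } where open Twins tw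

    generated-transfer : Twins P P′ → Generated H a → a ∈P P′ → a ∈P P
    generated-transfer {P} {P′} tw (gen-reg {x} x≈¬¬x) x∈P′ =
      ∈-resp-≈ (Eq.sym x≈¬¬x) (⇨-∈⁺ λ R P⊆R ¬x∈R → ⊥-∈ R ¬x∈R (aboveˡ R P⊆R))
      where
      open Twins tw
      ⊥-∈ : ∀ R → x ⇨ ⊥ ∈P R → R ⊆ P ⊎ P′ ⊆ R → ⊥ ∈P R
      ⊥-∈ R ¬x∈R (inj₁ R⊆P) with upperBound
      ... | T , P⊆T , P′⊆T = ⊥-elim (⊥-∉ (⇨-∈⁻ (P⊆T _ (R⊆P _ ¬x∈R)) (P′⊆T _ x∈P′)))
      ⊥-∈ R ¬x∈R (inj₂ P′⊆R) = ⇨-∈⁻ ¬x∈R (P′⊆R _ x∈P′)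
    generated-transfer tw gen-⊤ _ = ⊤-∈
    generated-transfer tw gen-⊥ ⊥∈P′ = ⊥-elim (⊥-∉ ⊥∈P′)
    generated-transfer tw (gen-∧ ga gb) a∧b∈P′ =
      ∧-∈⁺ (generated-transfer tw ga (∧-∈⁻ˡ a∧b∈P′)) (generated-transfer tw gb (∧-∈⁻ʳ a∧b∈P′))
    generated-transfer tw (gen-∨ ga gb) a∨b∈P′ =
      [ ∨-∈⁺ˡ ∘ generated-transfer tw ga , ∨-∈⁺ʳ ∘ generated-transfer tw gb ] (∨-∈⁻ a∨b∈P′)
    generated-transfer {P} {P′} tw (gen-⇨ {a} {b} ga gb) a⇨b∈P′ =
      ⇨-∈⁺ λ R P⊆R a∈R → b-∈ R P⊆R a∈R (aboveˡ R P⊆R)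
      where
      open Twins tw
      -- ⇨ is antitone in its first argument, so a is transferred in the opposite direction.
      b-∈ : ∀ R → P ⊆ R → a ∈P R → R ⊆ P ⊎ P′ ⊆ R → b ∈P R
      b-∈ R P⊆R a∈R (inj₁ R⊆P) =
        P⊆R _ (generated-transfer tw gb (⇨-∈⁻ a⇨b∈P′ (generated-transfer (twins-sym tw) ga (R⊆P _ a∈R))))
      b-∈ R P⊆R a∈R (inj₂ P′⊆R) = ⇨-∈⁻ (P′⊆R _ a⇨b∈P′) a∈R
    generated-transfer tw (gen-≈ x≈y gx) y∈P′ =
      ∈-resp-≈ x≈y (generated-transfer tw gx (∈-resp-≈ (Eq.sym x≈y) y∈P′))

    twins-equal : RegularHA H → Twins P P′ → P ≐ P′
    twins-equal reg tw =
        generator-∈⇒⊆ (generated-transfer (twins-sym tw) (reg _) generator-∈)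
      , generator-∈⇒⊆ (generated-transfer tw (reg _) generator-∈)

    above-if-covers-above : (∀ S → P ⋖ S → P′ ⊆ S) → ∀ R → P ⊆ R → R ⊆ P ⊎ P′ ⊆ R
    above-if-covers-above covers-above R P⊆R with ⊆⇒⊆-or-⊂ P⊆R
    ... | inj₁ R⊆P = inj₁ R⊆P
    ... | inj₂ P⊂R with cover-below P⊂R
    ...   | S , P⋖S , S⊆R = inj₂ (⊆-trans (covers-above S P⋖S) S⊆R)

    every-cover : (Φ : Point → Set Lv) → (∀ {S S′} → S ≐ S′ → Φ S → Φ S′) →
      ¬ (∃ λ k → Z ⋖ point k × ¬ Φ (point k)) → ∀ S → Z ⋖ S → Φ S
    every-cover Φ Φ-resp-≐ none S Z⋖S with cover-index Z⋖S
    ... | k , Z⋖k , k≐S = Φ-resp-≐ k≐S (stable λ ¬Φk → none (k , Z⋖k , ¬Φk))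

    regular⇒condI : RegularHA H → CondI H
    regular⇒condI reg P nonMax with nonMaximal⇒cover nonMax
    ... | S , P⋖S with em {∃ λ k → P ⋖ point k × ¬ (S ⊆ point k)}
    ...   | yes (k , P⋖k , S⊈k) = S , point k , ⋖⇒ImmSucc P⋖S , ⋖⇒ImmSucc P⋖k , S⊈k ∘ ⊆F⇒⊆ ∘ proj₁
    ...   | no S-below-covers = ⊥-elim (proj₂ (proj₁ P⋖S) (proj₂ (twins-equal reg twins)))
      where
      twins : Twins P S
      twins = record
        { upperBound = S , ⋖⇒⊆ P⋖S , ⊆-refl
        ; aboveˡ = above-if-covers-above (every-cover (S ⊆_) ⊆-resp-≐ S-below-covers)
        ; aboveʳ = λ R S⊆R → inj₂ (⊆-trans (⋖⇒⊆ P⋖S) S⊆R)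
        }

    regular⇒condII : RegularHA H → CondII H
    regular⇒condII reg P P′ nonMax _ P≠P′ same = P≠P′ (⊆⇒⊆F (proj₁ P≐P′) , ⊆⇒⊆F (proj₂ P≐P′))
      where
      covers-above : ∀ {P P′} → SameSucc H P P′ → ∀ S → P ⋖ S → P′ ⊆ S
      covers-above same S = ⋖⇒⊆ ∘ ImmSucc⇒⋖ ∘ proj₁ (same S) ∘ ⋖⇒ImmSucc
      P≐P′ : P ≐ P′
      P≐P′ = twins-equal reg record
        { upperBound = let S , P⋖S = nonMaximal⇒cover nonMax in S , ⋖⇒⊆ P⋖S , covers-above same S P⋖S
        ; aboveˡ = above-if-covers-above (covers-above same)
        ; aboveʳ = above-if-covers-above (covers-above (swap ∘ same))
        }

    -- (i) and (ii) imply regularity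

    Separated : Point → Point → Set Lv
    Separated X Z = Σ Carrier λ a → Generated H a × a ∈P X × ¬ (a ∈P Z)

    SeparatedAbove : Point → Point → Set (lsuc Lv)
    SeparatedAbove X Z = Σ Carrier λ b → Generated H b × ¬ (b ∈P Z) × (∀ R → X ⊂ R → b ∈P R)

    ⊈⇒witness : ¬ (X ⊆ Z) → Σ Carrier λ x → x ∈P X × ¬ (x ∈P Z)
    ⊈⇒witness X⊈Z = stable λ none → X⊈Z λ x x∈X → stable λ x∉Z → none (x , x∈X , x∉Z)

    maximal-separated : ¬ (∃ λ k → Z ⊂ point k) → ¬ (X ⊆ Z) → Separated X Z
    maximal-separated {Z} maximal X⊈Z with ⊈⇒witness X⊈Z
    ... | x , x∈X , x∉Z =
      (x ⇨ ⊥) ⇨ ⊥ , gen-reg (¬¬-isRegular x) , ∈-resp-≤ (x≤¬¬x x) x∈X , λ ¬¬x∈Z → ⊥-∉ (⇨-∈⁻ ¬¬x∈Z ¬x∈Z)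
      where
      ¬x∈Z : x ⇨ ⊥ ∈P Z
      ¬x∈Z = ⇨-∈⁺ λ R Z⊆R x∈R → ⊥-elim ([ (λ R⊆Z → x∉Z (R⊆Z _ x∈R)) , Z⊄ ] (⊆⇒⊆-or-⊂ Z⊆R))
        where
        Z⊄ : ∀ {R} → ¬ (Z ⊂ R)
        Z⊄ {R} Z⊂R = let k , kR , Rk = point-surjective R in maximal (k , ⊂-⊆-trans Z⊂R Rk)

    strictUpset-⊆ : (∀ S → Z ⋖ S → X ⊂ S) → ∀ R → Z ⊂ R → X ⊂ R
    strictUpset-⊆ X⊂covers R Z⊂R with cover-below Z⊂R
    ... | S , Z⋖S , S⊆R = ⊂-⊆-trans (X⊂covers S Z⋖S) S⊆R

    ⋖-of-strictUpsets : (∀ R → Z ⊂ R → X ⊂ R) → (∀ R → X ⊂ R → Z ⊂ R) → Z ⋖ S → X ⋖ S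
    ⋖-of-strictUpsets Z⇒X X⇒Z (Z⊂S , nothingBetween) =
      Z⇒X _ Z⊂S , λ k (X⊂k , k⊂S) → nothingBetween k (X⇒Z _ X⊂k , k⊂S)

    sameSucc-of-strictUpsets : (∀ R → Z ⊂ R → X ⊂ R) → (∀ R → X ⊂ R → Z ⊂ R) → SameSucc H Z X
    sameSucc-of-strictUpsets Z⇒X X⇒Z Q =
        ⋖⇒ImmSucc ∘ ⋖-of-strictUpsets {S = Q} Z⇒X X⇒Z ∘ ImmSucc⇒⋖
      , ⋖⇒ImmSucc ∘ ⋖-of-strictUpsets {S = Q} X⇒Z Z⇒X ∘ ImmSucc⇒⋖

    module Separation (condI : CondI H) (condII : CondII H) where

      weight : Point → Point → ℕ
      weight X Z = #above X + #above Z

      SeparationBelow : Point → Point → Set (lsuc Lv)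
      SeparationBelow X Z = ∀ X′ Z′ → weight X′ Z′ < weight X Z → ¬ (X′ ⊆ Z′) → Separated X′ Z′

      -- Two distinct covers of Z cannot both contain a cover S ⊆ X.
      covers-strictly-above : NonMaximal H Z → (∀ S → Z ⋖ S → X ⊆ S) → ∀ S → Z ⋖ S → X ⊂ S
      covers-strictly-above {Z} {X} nonMax X⊆covers S Z⋖S with condI Z nonMax
      ... | Q₁ , Q₂ , Z⋖Q₁ , Z⋖Q₂ , Q₁≠Q₂ = X⊆covers S Z⋖S , λ S⊆X →
        let Q₁⊆X = ⊆-trans (below-S Q₁ (ImmSucc⇒⋖ Z⋖Q₁) S⊆X) S⊆X
            Q₂⊆X = ⊆-trans (below-S Q₂ (ImmSucc⇒⋖ Z⋖Q₂) S⊆X) S⊆X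
        in Q₁≠Q₂ ( ⊆⇒⊆F (⊆-trans Q₁⊆X (X⊆covers Q₂ (ImmSucc⇒⋖ Z⋖Q₂)))
                 , ⊆⇒⊆F (⊆-trans Q₂⊆X (X⊆covers Q₁ (ImmSucc⇒⋖ Z⋖Q₁))))
        where
        below-S : ∀ Q → Z ⋖ Q → S ⊆ X → Q ⊆ S
        below-S Q Z⋖Q S⊆X = covers-incomparable Z⋖S Z⋖Q (⊆-trans S⊆X (X⊆covers Q Z⋖Q))

      cover-separated : SeparationBelow X Z → Z ⋖ Y → ¬ (X ⊆ Y) → Separated X Z
      cover-separated {X} ih Z⋖Y X⊈Y with ih X _ (ℕ.+-monoʳ-< (#above X) (#above-< (⋖⇒⊂ Z⋖Y))) X⊈Y
      ... | a , ga , a∈X , a∉Y = a , ga , a∈X , a∉Y ∘ ⋖⇒⊆ Z⋖Y _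

      strictUpset-separated : SeparationBelow X Z → ¬ (X ⊆ Z) → SeparatedAbove X Z
      strictUpset-separated {X} {Z} ih X⊈Z = ⋁ piece , ⋁-generated piece (proj₁ ∘ proj₂ ∘ part) , ⋁∉Z , ⋁∈
        where
        part : ∀ j → Σ Carrier λ b → Generated H b × ¬ (b ∈P Z) × (X ⊂ point j → b ∈P point j)
        part j with em {X ⊂ point j}
        ... | no X⊄j = ⊥ , gen-⊥ , ⊥-∉ , ⊥-elim ∘ X⊄j
        ... | yes X⊂j with ih (point j) Z (ℕ.+-monoˡ-< (#above Z) (#above-< X⊂j)) (X⊈Z ∘ ⊆-trans (proj₁ X⊂j))
        ...   | b , gb , b∈j , b∉Z = b , gb , b∉Z , λ _ → b∈j
        piece = proj₁ ∘ part
        ⋁∉Z : ¬ (⋁ piece ∈P Z)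
        ⋁∉Z ⋁b∈Z =
          let j , bj∈Z = ⋁-∈⁻ piece ⋁b∈Z
              _ , _ , bj∉Z , _ = part j
          in bj∉Z bj∈Z
        ⋁∈ : ∀ R → X ⊂ R → ⋁ piece ∈P R
        ⋁∈ R X⊂R =
          let j , jR , Rj = point-surjective R
              _ , _ , _ , bj∈j = part j
          in jR _ (⋁-∈⁺ piece j (bj∈j (⊂-⊆-trans X⊂R Rj)))

      implication-separated : SeparationBelow X Z → X ⋖ Y → ¬ (Z ⊂ Y) → ¬ (X ⊆ Z) → Separated X Z
      implication-separated {X} {Z} {Y} ih X⋖Y Z⊄Y X⊈Z =
        separated (ih Z Y smaller Z⊈Y) (strictUpset-separated ih X⊈Z)
        where
        X⊆Y = ⋖⇒⊆ X⋖Y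
        Z⊈Y : ¬ (Z ⊆ Y)
        Z⊈Y Z⊆Y = X⊈Z (⊆-trans X⊆Y (stable λ Y⊈Z → Z⊄Y (Z⊆Y , Y⊈Z)))
        smaller : weight Z Y < weight X Z
        smaller = ℕ.<-≤-trans (ℕ.+-monoʳ-< (#above Z) (#above-< (⋖⇒⊂ X⋖Y)))
                              (ℕ.≤-reflexive (ℕ.+-comm (#above Z) (#above X)))
        separated : Separated Z Y → SeparatedAbove X Z → Separated X Z
        separated (A , gA , A∈Z , A∉Y) (B , gB , B∉Z , B∈) =
          A ⇨ B , gen-⇨ gA gB , ⇨-∈⁺ B-∈ , λ A⇨B∈Z → B∉Z (⇨-∈⁻ A⇨B∈Z A∈Z)
          where
          B-∈ : ∀ R → X ⊆ R → A ∈P R → B ∈P R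
          B-∈ R X⊆R A∈R with ⊆⇒⊆-or-⊂ X⊆R
          ... | inj₁ R⊆X = ⊥-elim (A∉Y (X⊆Y _ (R⊆X _ A∈R)))
          ... | inj₂ X⊂R = B∈ R X⊂R

      separation-step : SeparationBelow X Z → ¬ (X ⊆ Z) → Separated X Z
      separation-step {X} {Z} ih X⊈Z with em {∃ λ k → Z ⊂ point k}
      ... | no maximal = maximal-separated maximal X⊈Z
      ... | yes (k , Z⊂k) with em {∃ λ j → Z ⋖ point j × ¬ (X ⊆ point j)}
      ...   | yes (j , Z⋖j , X⊈j) = cover-separated ih Z⋖j X⊈j
      ...   | no X-below-covers with em {∃ λ j → X ⋖ point j × ¬ (Z ⊂ point j)}
      ...     | yes (j , X⋖j , Z⊄j) = implication-separated ih X⋖j Z⊄j X⊈Z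
      ...     | no Z-below-covers =
        ⊥-elim (condII Z X nonMaxZ nonMaxX (X⊈Z ∘ ⊆F⇒⊆ ∘ proj₂)
                 (sameSucc-of-strictUpsets (strictUpset-⊆ X⊂covers) (strictUpset-⊆ Z⊂covers)))
        where
        nonMaxZ : NonMaximal H Z
        nonMaxZ = point k , ⊂⇒⊂F Z⊂k
        X⊂covers : ∀ S → Z ⋖ S → X ⊂ S
        X⊂covers = covers-strictly-above nonMaxZ
          (every-cover (X ⊆_) ⊆-resp-≐ X-below-covers)
        nonMaxX : NonMaximal H X
        nonMaxX = let S , Z⋖S = nonMaximal⇒cover nonMaxZ in S , ⊂⇒⊂F (X⊂covers S Z⋖S)
        Z⊂covers : ∀ S → X ⋖ S → Z ⊂ S
        Z⊂covers = every-cover (Z ⊂_) ⊂-resp-≐ Z-below-covers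

      separate : ¬ (X ⊆ Z) → Separated X Z
      separate {X} {Z} = go X Z (<-wellFounded (weight X Z))
        where
        go : ∀ X Z → Acc _<_ (weight X Z) → ¬ (X ⊆ Z) → Separated X Z
        go X Z (acc smaller) = separation-step λ X′ Z′ lt → go X′ Z′ (smaller lt)

      upset-generated : ∀ P → Σ Carrier λ b → Generated H b × b ∈P P × (∀ Q → b ∈P Q → P ⊆ Q)
      upset-generated P =
        ⋀ piece , ⋀-generated piece (proj₁ ∘ proj₂ ∘ part) , ⋀-∈⁺ piece (proj₁ ∘ proj₂ ∘ proj₂ ∘ part) , ⋀∈⇒⊆
        where
        part : ∀ k → Σ Carrier λ b → Generated H b × b ∈P P × (¬ (P ⊆ point k) → ¬ (b ∈P point k))
        part k with em {P ⊆ point k}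
        ... | yes P⊆k = ⊤ , gen-⊤ , ⊤-∈ , λ P⊈k → ⊥-elim (P⊈k P⊆k)
        ... | no P⊈k with separate P⊈k
        ...   | b , gb , b∈P , b∉k = b , gb , b∈P , λ _ → b∉k
        piece = proj₁ ∘ part
        ⋀∈⇒⊆ : ∀ Q → ⋀ piece ∈P Q → P ⊆ Q
        ⋀∈⇒⊆ Q ⋀b∈Q =
          let k , kQ , Qk = point-surjective Q
              _ , _ , _ , bk∉k = part k
          in stable λ P⊈Q → bk∉k (λ P⊆k → P⊈Q (⊆-trans P⊆k kQ)) (Qk _ (⋀-∈⁻ piece ⋀b∈Q k))

      regular : RegularHA H
      regular a = gen-≈ (Eq.sym a≈⋁) (⋁-generated piece (proj₁ ∘ proj₂ ∘ part))
        where
        part : ∀ k → Σ Carrier λ b → Generated H b × (a ∈P point k → b ∈P point k) × (∀ Q → b ∈P Q → a ∈P Q)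
        part k with em {a ∈P point k}
        ... | no a∉k = ⊥ , gen-⊥ , ⊥-elim ∘ a∉k , λ Q ⊥∈Q → ⊥-elim (⊥-∉ ⊥∈Q)
        ... | yes a∈k with upset-generated (point k)
        ...   | b , gb , b∈k , b∈⇒⊆ = b , gb , (λ _ → b∈k) , λ Q b∈Q → b∈⇒⊆ Q b∈Q _ a∈k
        piece = proj₁ ∘ part
        a≈⋁ : a ≈ ⋁ piece
        a≈⋁ = ≈-pointwise
          (λ Q a∈Q →
            let k , kQ , Qk = point-surjective Q
                _ , _ , bk∈k , _ = part k
            in kQ _ (⋁-∈⁺ piece k (bk∈k (Qk _ a∈Q))))
          (λ Q ⋁b∈Q →
            let k , bk∈Q = ⋁-∈⁻ piece ⋁b∈Q
                _ , _ , _ , bk⇒a = part k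
            in bk⇒a Q bk∈Q)

    -- Subdirect irreducibility

    Agree : Carrier → Carrier → Carrier → Set (lsuc Lv)
    Agree d x y = ∀ Q → d ∈P Q → x ∈P Q → y ∈P Q

    ∧-agree : ∀ {d} → Agree d x y → Agree d u v → Agree d (x ∧ u) (y ∧ v)
    ∧-agree x⊑y u⊑v Q d∈Q x∧u∈Q = ∧-∈⁺ (x⊑y Q d∈Q (∧-∈⁻ˡ x∧u∈Q)) (u⊑v Q d∈Q (∧-∈⁻ʳ x∧u∈Q))

    ∨-agree : ∀ {d} → Agree d x y → Agree d u v → Agree d (x ∨ u) (y ∨ v)
    ∨-agree x⊑y u⊑v Q d∈Q = [ ∨-∈⁺ˡ ∘ x⊑y Q d∈Q , ∨-∈⁺ʳ ∘ u⊑v Q d∈Q ] ∘ ∨-∈⁻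

    ⇨-agree : ∀ {d} → Agree d y x → Agree d u v → Agree d (x ⇨ u) (y ⇨ v)
    ⇨-agree y⊑x u⊑v Q d∈Q x⇨u∈Q = ⇨-∈⁺ λ R Q⊆R y∈R →
      u⊑v R (Q⊆R _ d∈Q) (⇨-∈⁻ (Q⊆R _ x⇨u∈Q) (y⊑x R (Q⊆R _ d∈Q) y∈R))

    ∧≈⇒agree : ∀ {d} → x ∧ d ≈ y ∧ d → Agree d x y
    ∧≈⇒agree x∧d≈y∧d Q d∈Q x∈Q = ∧-∈⁻ˡ (∈-resp-≈ x∧d≈y∧d (∧-∈⁺ x∈Q d∈Q))

    agree⇒∧≈ : ∀ {d} → Agree d x y → Agree d y x → x ∧ d ≈ y ∧ d
    agree⇒∧≈ x⊑y y⊑x = ≈-pointwise (transfer x⊑y) (transfer y⊑x)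
      where
      transfer : ∀ {d x y} → Agree d x y → ∀ Q → x ∧ d ∈P Q → y ∧ d ∈P Q
      transfer x⊑y Q x∧d∈Q = ∧-∈⁺ (x⊑y Q (∧-∈⁻ʳ x∧d∈Q) (∧-∈⁻ˡ x∧d∈Q)) (∧-∈⁻ʳ x∧d∈Q)

    filterCongruence : Carrier → Congruence H
    filterCongruence d = record
      { θ = λ x y → Lift Lv (x ∧ d ≈ y ∧ d)
      ; ≈⇒θ = λ x≈y → lift (agree⇒∧≈ (λ _ _ → ∈-resp-≈ x≈y) (λ _ _ → ∈-resp-≈ (Eq.sym x≈y)))
      ; θ-sym = λ x∼y → lift (Eq.sym (lower x∼y))
      ; θ-trans = λ x∼y y∼z → lift (Eq.trans (lower x∼y) (lower y∼z))
      ; ∧-cong = λ x∼y u∼v → lift (agree⇒∧≈ (∧-agree (fwd x∼y) (fwd u∼v)) (∧-agree (bwd x∼y) (bwd u∼v)))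
      ; ∨-cong = λ x∼y u∼v → lift (agree⇒∧≈ (∨-agree (fwd x∼y) (fwd u∼v)) (∨-agree (bwd x∼y) (bwd u∼v)))
      ; ⇨-cong = λ x∼y u∼v → lift (agree⇒∧≈ (⇨-agree (bwd x∼y) (fwd u∼v)) (⇨-agree (fwd x∼y) (bwd u∼v)))
      }
      where
      fwd : Lift Lv (x ∧ d ≈ y ∧ d) → Agree d x y
      fwd = ∧≈⇒agree ∘ lower
      bwd : Lift Lv (x ∧ d ≈ y ∧ d) → Agree d y x
      bwd = ∧≈⇒agree ∘ Eq.sym ∘ lower

    filterCongruence-nonTrivial : ∀ {d} → ¬ (d ≈ ⊤) → NonTrivialCong H (filterCongruence d)
    filterCongruence-nonTrivial {d} d≉⊤ = d , ⊤ , lift (agree⇒∧≈ (λ _ _ _ → ⊤-∈) (λ _ d∈Q _ → d∈Q)) , d≉⊤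

    subdirectlyIrreducible⇒opremum : SubdirectlyIrreducible H → ∃ IsOpremum
    subdirectlyIrreducible⇒opremum (μ , (a , b , a∼b , a≉b) , least) =
      (a ⇨ b) ∧ (b ⇨ a) , a≉b ∘ biimplication-≈⊤ , below
      where
      below : ∀ x → ¬ (x ≈ ⊤) → x ≤ (a ⇨ b) ∧ (b ⇨ a)
      below x x≉⊤ = ≤-pointwise λ Q x∈Q →
        ∧-∈⁺ (⇨-∈⁺ λ R Q⊆R → ∧≈⇒agree a∧x≈b∧x R (Q⊆R _ x∈Q))
             (⇨-∈⁺ λ R Q⊆R → ∧≈⇒agree (Eq.sym a∧x≈b∧x) R (Q⊆R _ x∈Q))
        where
        a∧x≈b∧x = lower (least (filterCongruence x) (filterCongruence-nonTrivial x≉⊤) a b a∼b)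

    rooted⇒opremum : Rooted H → ∃ IsOpremum
    rooted⇒opremum (root , root⊆) = ⋁ piece , ⋁≉⊤ , below
      where
      root-⊤ : x ∈P root → x ≈ ⊤
      root-⊤ x∈root = ≈-pointwise (λ _ _ → ⊤-∈) (λ Q _ → ⊆F⇒⊆ (root⊆ Q) _ x∈root)
      part : ∀ i → Σ Carrier λ b → (¬ (elem i ≈ ⊤) → elem i ≤ b) × ¬ (b ∈P root)
      part i with elem i ≈? ⊤
      ... | yes ei≈⊤ = ⊥ , (λ ei≉⊤ → ⊥-elim (ei≉⊤ ei≈⊤)) , ⊥-∉
      ... | no ei≉⊤ = elem i , (λ _ → ≤-refl) , ei≉⊤ ∘ root-⊤
      piece = proj₁ ∘ part
      ⋁≉⊤ : ¬ (⋁ piece ≈ ⊤)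
      ⋁≉⊤ ⋁≈⊤ =
        let i , bi∈root = ⋁-∈⁻ piece (∈-resp-≈ (Eq.sym ⋁≈⊤) ⊤-∈)
            _ , _ , bi∉root = part i
        in bi∉root bi∈root
      below : ∀ x → ¬ (x ≈ ⊤) → x ≤ ⋁ piece
      below x x≉⊤ =
        let i , ei≈x = elem-surjective x
            _ , ei≤bi , _ = part i
        in ≤-pointwise λ Q x∈Q →
             ⋁-∈⁺ piece i (∈-resp-≤ (ei≤bi (x≉⊤ ∘ Eq.trans (Eq.sym ei≈x))) (∈-resp-≈ (Eq.sym ei≈x) x∈Q))

    opremum⇒subdirectlyIrreducible : ∀ {d} → IsOpremum d → SubdirectlyIrreducible H
    opremum⇒subdirectlyIrreducible {d} (d≉⊤ , below) = filterCongruence d , filterCongruence-nonTrivial d≉⊤ , least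
      where
      least : ∀ Θ → NonTrivialCong H Θ → ∀ x y → θ (filterCongruence d) x y → θ Θ x y
      least Θ (a , b , a∼b , a≉b) x y (lift x∧d≈y∧d) = begin
        x      ≈⟨ ≈⇒θ Θ (Eq.sym (identityʳ x)) ⟩
        x ∧ ⊤  ≈⟨ ∧-cong Θ (≈⇒θ Θ Eq.refl) (θ-sym Θ d∼⊤) ⟩
        x ∧ d  ≈⟨ ≈⇒θ Θ x∧d≈y∧d ⟩
        y ∧ d  ≈⟨ ∧-cong Θ (≈⇒θ Θ Eq.refl) d∼⊤ ⟩
        y ∧ ⊤  ≈⟨ ≈⇒θ Θ (identityʳ y) ⟩
        y      ∎
        where
        open SetoidReasoning (congruenceSetoid Θ)
        a⇔b = (a ⇨ b) ∧ (b ⇨ a)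
        a⇔b∼⊤ : θ Θ a⇔b ⊤
        a⇔b∼⊤ = begin
          a⇔b                ≈⟨ ∧-cong Θ (⇨-cong Θ a∼b (≈⇒θ Θ Eq.refl)) (⇨-cong Θ (≈⇒θ Θ Eq.refl) a∼b) ⟩
          (b ⇨ b) ∧ (b ⇨ b)  ≈⟨ ≈⇒θ Θ (Eq.trans (∧-idempotent _) ⇨-unit) ⟩
          ⊤                  ∎
        d∼⊤ : θ Θ d ⊤
        d∼⊤ = begin
          d          ≈⟨ ≈⇒θ Θ (Eq.sym (x≤y⇒x∨y≈y (below a⇔b (a≉b ∘ biimplication-≈⊤)))) ⟩
          a⇔b ∨ d    ≈⟨ ∨-cong Θ a⇔b∼⊤ (≈⇒θ Θ Eq.refl) ⟩
          ⊤ ∨ d      ≈⟨ ≈⇒θ Θ (∨-zeroˡ d) ⟩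
          ⊤          ∎

theorem3p9 : ∀ {c ℓ₁ ℓ₂} → ExcludedMiddle (c ⊔ ℓ₁ ⊔ ℓ₂) →
    (H : HeytingAlgebra c ℓ₁ ℓ₂) → PrimeFilterTheorem H →
    ((FiniteHA H × RegularHA H) ⇔ (FiniteDual H × CondI H × CondII H))
    × ((FiniteHA H × RegularHA H × SubdirectlyIrreducible H)
        ⇔ (FiniteDual H × Rooted H × CondI H × CondII H))
theorem3p9 em H pft = mk⇔ regular⇒conditions conditions⇒regular , mk⇔ irreducible⇒rooted rooted⇒irreducible
  where
  open Duality em H pft

  regular⇒conditions : FiniteHA H × RegularHA H → FiniteDual H × CondI H × CondII H
  regular⇒conditions (fha , reg) = finiteDual , regular⇒condI reg , regular⇒condII reg
    where open Finite fha

  conditions⇒regular : FiniteDual H × CondI H × CondII H → FiniteHA H × RegularHA H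
  conditions⇒regular (fd , condI , condII) = fha , Finite.Separation.regular fha condI condII
    where fha = FromFiniteDual.finiteHA fd

  irreducible⇒rooted : FiniteHA H × RegularHA H × SubdirectlyIrreducible H →
                       FiniteDual H × Rooted H × CondI H × CondII H
  irreducible⇒rooted (fha , reg , si) =
    let fd , condI , condII = regular⇒conditions (fha , reg)
    in fd , opremum⇒rooted (proj₂ (subdirectlyIrreducible⇒opremum si)) , condI , condII
    where open Finite fha

  rooted⇒irreducible : FiniteDual H × Rooted H × CondI H × CondII H →
                       FiniteHA H × RegularHA H × SubdirectlyIrreducible H
  rooted⇒irreducible (fd , rooted , condI , condII) =
    let fha , reg = conditions⇒regular (fd , condI , condII)
    in fha , reg , Finite.opremum⇒subdirectlyIrreducible fha (proj₂ (Finite.rooted⇒opremum fha rooted))
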